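{- Let $A$ be a meet-complemented lattice in which both $\Box a$ and $\Diamond a$ exist for every $a\in A$. Then the following are equivalent: (i) $\Diamond\Box a\le\Box a$ for all $a\in A$; (ii) $\Diamond a\le\Box\Diamond a$ for all $a\in A$.
   Context: A meet-complemented lattice is a lattice $(A,\wedge,\vee)$, not necessarily distributive, such that for every $a\in A$ the element $\neg a=\max\{b\in A: a\wedge b\le c\text{ for all }c\in A\}$ exists; it is bounded, with least element $0$ and greatest element $1$. For $a\in A$, $\Box a=\max\{b\in A: a\vee\neg b=1\}$ and $\Diamond a=\min\{b\in A: \neg a\vee b=1\}$. -}

module Defs where

open import Level using (Level; _⊔_)
open import Data.Product using (_×_)
open import Relation.Binary.Lattice.Bundles using (BoundedLattice)

module _ {c ℓ₁ ℓ₂ : Level} (L : BoundedLattice c ℓ₁ ℓ₂) where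
  open BoundedLattice L

  IsMaxOf : ∀ {p} → (Carrier → Set p) → Carrier → Set (c ⊔ ℓ₂ ⊔ p)
  IsMaxOf P m = P m × (∀ b → P b → b ≤ m)

  IsMinOf : ∀ {p} → (Carrier → Set p) → Carrier → Set (c ⊔ ℓ₂ ⊔ p)
  IsMinOf P m = P m × (∀ b → P b → m ≤ b)

  IsMeetComplement : (Carrier → Carrier) → Set (c ⊔ ℓ₂)
  IsMeetComplement neg = ∀ a → IsMaxOf (λ b → ∀ x → (a ∧ b) ≤ x) (neg a)

  IsBox : (Carrier → Carrier) → (Carrier → Carrier) → Set (c ⊔ ℓ₁ ⊔ ℓ₂)
  IsBox neg box = ∀ a → IsMaxOf (λ b → (a ∨ neg b) ≈ ⊤) (box a)

  IsDiamond : (Carrier → Carrier) → (Carrier → Carrier) → Set (c ⊔ ℓ₁ ⊔ ℓ₂)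
  IsDiamond neg dia = ∀ a → IsMinOf (λ b → (neg a ∨ b) ≈ ⊤) (dia a)

module Submission where

-- The proof rests on the observation that ◇ and □ behave like a monotone
-- Galois connection ◇ ⊣ □: both are monotone, a ≤ □◇a (unit) and
-- ◇□a ≤ a (counit).  For ANY such pair f ⊣ g of monotone maps on a preorder
-- one has  (∀a. f(g a) ≤ g a) ⇔ (∀a. f a ≤ g(f a)):  given the left-hand side,
-- f a ≤ f(g(f a)) ≤ g(f a); given the right-hand side, f(g a) ≤ g(f(g a)) ≤ g a.

open import Defs
open import Level using (Level)
open import Data.Product using (proj₁; proj₂)
open import Function.Bundles using (_⇔_; mk⇔)
open import Relation.Binary.Bundles using (Preorder)
open import Relation.Binary.Lattice.Bundles using (BoundedLattice)
import Relation.Binary.Lattice.Properties.JoinSemilattice as JoinProperties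
import Relation.Binary.Lattice.Properties.MeetSemilattice as MeetProperties
import Relation.Binary.Reasoning.Preorder as PreorderReasoning

module _ {c ℓ₁ ℓ₂ : Level} (P : Preorder c ℓ₁ ℓ₂) where
  open Preorder P renaming (_≲_ to _≤_)
  open PreorderReasoning P

  adjoint-pair-inflation⇔ : (f g : Carrier → Carrier)
    → (∀ {x y} → x ≤ y → f x ≤ f y)
    → (∀ {x y} → x ≤ y → g x ≤ g y)
    → (∀ x → x ≤ g (f x))
    → (∀ x → f (g x) ≤ x)
    → (∀ x → f (g x) ≤ g x) ⇔ (∀ x → f x ≤ g (f x))
  adjoint-pair-inflation⇔ f g f-mono g-mono unit counit = mk⇔ forward backward
    where
    forward : (∀ x → f (g x) ≤ g x) → ∀ x → f x ≤ g (f x)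
    forward fg≤g x = begin
      f x           ∼⟨ f-mono (unit x) ⟩
      f (g (f x))   ∼⟨ fg≤g (f x) ⟩
      g (f x)       ∎

    backward : (∀ x → f x ≤ g (f x)) → ∀ x → f (g x) ≤ g x
    backward f≤gf x = begin
      f (g x)       ∼⟨ f≤gf (g x) ⟩
      g (f (g x))   ∼⟨ g-mono (counit x) ⟩
      g x           ∎

module _ {c ℓ₁ ℓ₂ : Level} (L : BoundedLattice c ℓ₁ ℓ₂) where
  open BoundedLattice L
  open JoinProperties joinSemilattice using (∨-comm; ∨-monotonic)
  open MeetProperties meetSemilattice using (∧-monotonic)

  ∨≈⊤-comm : ∀ {x y} → x ∨ y ≈ ⊤ → y ∨ x ≈ ⊤
  ∨≈⊤-comm {x} {y} x∨y≈⊤ = Eq.trans (∨-comm y x) x∨y≈⊤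

  ∨≈⊤-mono : ∀ {x y x′ y′} → x ≤ x′ → y ≤ y′ → x ∨ y ≈ ⊤ → x′ ∨ y′ ≈ ⊤
  ∨≈⊤-mono x≤x′ y≤y′ x∨y≈⊤ =
    antisym (maximum _) (trans (reflexive (Eq.sym x∨y≈⊤)) (∨-monotonic x≤x′ y≤y′))

  -- The meet-complement is antitone: if x ≤ y then x ∧ ¬y ≤ y ∧ ¬y is
  -- below everything, so ¬y lies below the maximum ¬x.
  neg-antitone : ∀ {neg} → IsMeetComplement L neg
    → ∀ {x y} → x ≤ y → neg y ≤ neg x
  neg-antitone {neg} isNeg {x} {y} x≤y = proj₂ (isNeg x) (neg y) x∧¬y-bottom
    where
    x∧¬y-bottom : ∀ z → x ∧ neg y ≤ z
    x∧¬y-bottom z = trans (∧-monotonic x≤y refl) (proj₁ (isNeg y) z)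

  -- □ is monotone: if x ≤ y then □x also satisfies y ∨ ¬(□x) = ⊤.
  box-monotone : ∀ {neg box} → IsBox L neg box
    → ∀ {x y} → x ≤ y → box x ≤ box y
  box-monotone {box = box} isBox {x} {y} x≤y =
    proj₂ (isBox y) (box x) (∨≈⊤-mono x≤y refl (proj₁ (isBox x)))

  -- ◇ is monotone: if x ≤ y then ¬x ∨ ◇y = ⊤, since ¬y ≤ ¬x.
  dia-monotone : ∀ {neg dia} → IsMeetComplement L neg → IsDiamond L neg dia
    → ∀ {x y} → x ≤ y → dia x ≤ dia y
  dia-monotone {neg} {dia} isNeg isDia {x} {y} x≤y =
    proj₂ (isDia x) (dia y) (∨≈⊤-mono (neg-antitone isNeg x≤y) refl (proj₁ (isDia y)))

  -- Unit of ◇ ⊣ □: the defining equation ¬a ∨ ◇a = ⊤ says a is a candidate for □◇a.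
  box-dia-unit : ∀ {neg box dia} → IsBox L neg box → IsDiamond L neg dia
    → ∀ a → a ≤ box (dia a)
  box-dia-unit {box = box} {dia} isBox isDia a =
    proj₂ (isBox (dia a)) a (∨≈⊤-comm (proj₁ (isDia a)))

  -- Counit of ◇ ⊣ □: the defining equation a ∨ ¬□a = ⊤ says a is a candidate for ◇□a.
  dia-box-counit : ∀ {neg box dia} → IsBox L neg box → IsDiamond L neg dia
    → ∀ a → dia (box a) ≤ a
  dia-box-counit {box = box} {dia} isBox isDia a =
    proj₂ (isDia (box a)) a (∨≈⊤-comm (proj₁ (isBox a)))

proposition19 : ∀ {c ℓ₁ ℓ₂ : Level} (L : BoundedLattice c ℓ₁ ℓ₂)
    → (neg box dia : BoundedLattice.Carrier L → BoundedLattice.Carrier L)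
    → IsMeetComplement L neg
    → IsBox L neg box
    → IsDiamond L neg dia
    → (∀ a → BoundedLattice._≤_ L (dia (box a)) (box a))
    ⇔ (∀ a → BoundedLattice._≤_ L (dia a) (box (dia a)))
proposition19 L neg box dia isNeg isBox isDia =
  adjoint-pair-inflation⇔ (BoundedLattice.preorder L) dia box
    (dia-monotone L isNeg isDia)
    (box-monotone L isBox)
    (box-dia-unit L isBox isDia)
    (dia-box-counit L isBox isDia)
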